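{- Let $T$ be an isometric subtree of a graph $G$, let $c\in V(T)$ and $r\in V(G)$. If $v_1,v_2\in V(T)$ lie in different components of $T-\{c\}$ and $d(c,v_1)>d(r,v_1)$, then $d(c,v_2)<d(r,v_2)$.
   Context: $d=d_G$ denotes the shortest-path distance in $G$. A subgraph $H$ of $G$ is isometric if $d_H(u,v)=d_G(u,v)$ for all vertices $u,v$ of $H$. (In the paper, $c$ is the position of a cop and $r$ the position of the robber.) -}

module Defs where

open import Data.Nat using (ℕ; zero; suc; _≤_; _<_)
open import Data.Fin using (Fin)
open import Data.Product using (Σ; ∃; _×_; _,_)
open import Data.List using (List; []; _∷_)
open import Data.List.Relation.Unary.Unique.Propositional using (Unique)
open import Relation.Nullary using (¬_)
open import Relation.Binary.PropositionalEquality using (_≡_; _≢_)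

record Graph : Set₁ where
  field
    n      : ℕ
    Adj    : Fin n → Fin n → Set
    sym    : ∀ {u v} → Adj u v → Adj v u
    irrefl : ∀ {u} → ¬ Adj u u

data Walk {V : Set} (E : V → V → Set) : V → V → ℕ → Set where
  []  : ∀ {u} → Walk E u u zero
  _∷_ : ∀ {u w v k} → E u w → Walk E w v k → Walk E u v (suc k)

verts : ∀ {V : Set} {E : V → V → Set} {u v k} → Walk E u v k → List V
verts {u = u} []       = u ∷ []
verts {u = u} (_ ∷ p) = u ∷ verts p

tailL : ∀ {A : Set} → List A → List A
tailL []       = []
tailL (_ ∷ xs) = xs

-- Shortest-path distance, as a relation: Dist E u v k  means  d(u,v) = k.
Dist : ∀ {V : Set} → (V → V → Set) → V → V → ℕ → Set
Dist E u v k = Walk E u v k × (∀ j → Walk E u v j → k ≤ j)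

-- A cycle: closed walk of length ≥ 3 whose vertices (start counted once) are distinct.
HasCycle : ∀ {V : Set} → (V → V → Set) → Set
HasCycle {V} E = Σ V λ u → Σ ℕ λ k → Σ (Walk E u u k) λ p → (3 ≤ k) × Unique (tailL (verts p))

record Subgraph (G : Graph) : Set₁ where
  open Graph G
  field
    InV      : Fin n → Set
    Edge     : Fin n → Fin n → Set
    edge-sym : ∀ {u v} → Edge u v → Edge v u
    edge-adj : ∀ {u v} → Edge u v → Adj u v
    edge-inˡ : ∀ {u v} → Edge u v → InV u
    edge-inʳ : ∀ {u v} → Edge u v → InV v

module _ {G : Graph} (T : Subgraph G) where
  open Graph G
  open Subgraph T

  IsTree : Set
  IsTree = (∀ u v → InV u → InV v → ∃ λ k → Walk Edge u v k) × ¬ HasCycle Edge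

  IsIsometric : Set
  IsIsometric = ∀ u v → InV u → InV v → ∀ k →
    (Dist Edge u v k → Dist Adj u v k) × (Dist Adj u v k → Dist Edge u v k)

  EdgeMinus : Fin n → Fin n → Fin n → Set
  EdgeMinus c u w = Edge u w × u ≢ c × w ≢ c

  DifferentComponents : Fin n → Fin n → Fin n → Set
  DifferentComponents c v₁ v₂ =
    InV v₁ × InV v₂ × v₁ ≢ c × v₂ ≢ c × ¬ (∃ λ k → Walk (EdgeMinus c) v₁ v₂ k)

-- Every T-path from v₁ to v₂ passes through c, so by isometry
-- d(v₁,v₂) = d(v₁,c) + d(c,v₂). If also d(r,v₂) ≤ d(c,v₂), then the walk
-- v₁ → r → v₂ would have length d(r,v₁) + d(r,v₂) < d(c,v₁) + d(c,v₂) = d(v₁,v₂).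
-- The shortest v₁–v₂ walk exists only up to double negation, which suffices
-- because the conclusion is decidable.
module Submission where

open import Defs
open import Data.Nat using (ℕ; suc; _+_; _≤_; _<_; _≤?_; _<?_; s≤s)
open import Data.Nat.Properties
  using (≤-refl; ≤-trans; ≰⇒>; ≮⇒≥; <⇒≱; +-mono-≤; +-mono-<-≤)
open import Data.Fin using (Fin)
open import Data.Fin.Properties using (_≟_)
open import Data.Product using (Σ; ∃; ∃₂; _×_; _,_; proj₁; proj₂)
open import Data.Empty using (⊥-elim)
open import Relation.Nullary using (¬_; yes; no)
open import Relation.Binary.PropositionalEquality using (_≡_; refl; _≢_; subst)

module _ {V : Set} {E : V → V → Set} where

  _∷ʳ_ : ∀ {u v w k} → Walk E u v k → E v w → Walk E u w (suc k)
  []      ∷ʳ e = e ∷ []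
  (f ∷ p) ∷ʳ e = f ∷ (p ∷ʳ e)

  _++ʷ_ : ∀ {u v w k m} → Walk E u v k → Walk E v w m → Walk E u w (k + m)
  []      ++ʷ q = q
  (e ∷ p) ++ʷ q = e ∷ (p ++ʷ q)

  reverseʷ : (∀ {x y} → E x y → E y x) → ∀ {u v k} → Walk E u v k → Walk E v u k
  reverseʷ sym []      = []
  reverseʷ sym (e ∷ p) = reverseʷ sym p ∷ʳ sym e

mapʷ : ∀ {V : Set} {E F : V → V → Set} → (∀ {x y} → E x y → F x y) →
       ∀ {u v k} → Walk E u v k → Walk F u v k
mapʷ f []      = []
mapʷ f (e ∷ p) = f e ∷ mapʷ f p

module _ (P : ℕ → Set) where

  Least : Set
  Least = Σ ℕ λ k → P k × (∀ j → P j → k ≤ j)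

  ¬least⇒¬below : ¬ Least → ∀ M N → N < M → ¬ P N
  ¬least⇒¬below ¬least (suc M) N (s≤s N≤M) pN = ¬least (N , pN , minimal)
    where
    minimal : ∀ j → P j → N ≤ j
    minimal j pj with N ≤? j
    ... | yes N≤j = N≤j
    ... | no  N≰j = ⊥-elim (¬least⇒¬below ¬least M j (≤-trans (≰⇒> N≰j) N≤M) pj)

  ¬¬least : ∀ {N} → P N → ¬ ¬ Least
  ¬¬least {N} pN ¬least = ¬least⇒¬below ¬least (suc N) N ≤-refl pN

module _ {G : Graph} (T : Subgraph G) where
  open Graph G
  open Subgraph T

  walk-through-cut : ∀ {c u v k} → u ≢ c → ¬ (∃ λ m → Walk (EdgeMinus T c) u v m) →
    Walk Edge u v k → ∃₂ λ k₁ k₂ → Walk Edge u c k₁ × Walk Edge c v k₂ × k₁ + k₂ ≡ k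
  walk-through-cut u≢c separated [] = ⊥-elim (separated (0 , []))
  walk-through-cut {c} u≢c separated (_∷_ {w = w} e p) with w ≟ c
  ... | yes refl = 1 , _ , e ∷ [] , p , refl
  ... | no  w≢c with walk-through-cut w≢c
                       (λ (m , q) → separated (suc m , (e , u≢c , w≢c) ∷ q)) p
  ...   | k₁ , k₂ , p₁ , p₂ , refl = suc k₁ , k₂ , e ∷ p₁ , p₂ , refl

  dist-via-cut : IsIsometric T → ∀ {c v₁ v₂ a₁ a₂ d} → DifferentComponents T c v₁ v₂ →
    Dist Adj c v₁ a₁ → Dist Adj c v₂ a₂ → Dist Adj v₁ v₂ d → a₁ + a₂ ≤ d
  dist-via-cut iso {a₁ = a₁} {a₂} (v₁∈T , v₂∈T , v₁≢c , _ , separated)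
               (_ , min₁) (_ , min₂) shortest
    with walk-through-cut v₁≢c separated (proj₁ (proj₂ (iso _ _ v₁∈T v₂∈T _) shortest))
  ... | k₁ , k₂ , p₁ , p₂ , k₁+k₂≡d =
    subst (a₁ + a₂ ≤_) k₁+k₂≡d
      (+-mono-≤ (min₁ k₁ (mapʷ edge-adj (reverseʷ edge-sym p₁))) (min₂ k₂ (mapʷ edge-adj p₂)))

mainTheorem7 : (G : Graph) (T : Subgraph G) → IsTree T → IsIsometric T →
    (c r v₁ v₂ : Fin (Graph.n G)) → Subgraph.InV T c →
    DifferentComponents T c v₁ v₂ →
    (Σ ℕ λ a → Σ ℕ λ b → Dist (Graph.Adj G) c v₁ a × Dist (Graph.Adj G) r v₁ b × b < a) →
    ∀ a b → Dist (Graph.Adj G) c v₂ a → Dist (Graph.Adj G) r v₂ b → a < b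
mainTheorem7 G T _ iso c r v₁ v₂ _ sep (a₁ , b₁ , cv₁ , (rv₁ , _) , b₁<a₁) a₂ b₂ cv₂ (rv₂ , _)
  with a₂ <? b₂
... | yes a₂<b₂ = a₂<b₂
... | no  a₂≮b₂ = ⊥-elim (¬¬least (λ j → Walk Adj v₁ v₂ j) detour too-short)
  where
  open Graph G
  detour : Walk Adj v₁ v₂ (b₁ + b₂)
  detour = reverseʷ sym rv₁ ++ʷ rv₂
  -- Least (λ j → Walk Adj v₁ v₂ j) unfolds to Σ ℕ (Dist Adj v₁ v₂).
  too-short : ¬ Least (λ j → Walk Adj v₁ v₂ j)
  too-short (d , shortest) =
    <⇒≱ (+-mono-<-≤ b₁<a₁ (≮⇒≥ a₂≮b₂))
        (≤-trans (dist-via-cut T iso sep cv₁ cv₂ shortest) (proj₂ shortest _ detour))
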